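{- Let $G$ be a finite simple graph. Then $$\lambda(\mathcal{D}[G])=\begin{cases}2\lambda(G), & \text{if } \lambda(G)=\delta(G),\\ 4\lambda(G), & \text{if } \lambda(G)\le\frac{\delta(G)}{2},\\ 2\delta(G), & \text{if } \frac{\delta(G)}{2}<\lambda(G)<\delta(G),\end{cases}$$ where $\lambda$ denotes edge-connectivity and $\delta$ minimum degree.
   Context: The total graph $T_2$ is $K_2$ with a loop added at each of its two vertices. The double graph is $\mathcal{D}[G]=G\times T_2$ (Kronecker product): it has vertex set $V(G)\times\{0,1\}$ and $(u,i)$ is adjacent to $(v,j)$ iff $uv\in E(G)$. -}

module Defs where

open import Data.Nat using (ℕ; zero; suc; _+_; _*_; _<_; _≤_)
open import Data.Fin using (Fin; quotient; _≟_)
open import Data.Bool using (Bool; true; false; if_then_else_; _∧_; _∨_; not)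
open import Data.List using (List; length; map; allFin)
open import Data.Bool.ListAction using (any)
open import Data.Nat.ListAction using (sum)
open import Data.Product using (_×_; _,_; Σ; ∃)
open import Data.Sum using (_⊎_)
open import Relation.Nullary using (¬_)
open import Relation.Nullary.Decidable using (⌊_⌋)
open import Relation.Binary.PropositionalEquality using (_≡_; refl; cong)
open import Relation.Binary.Construct.Closure.ReflexiveTransitive using (Star)

record Graph : Set where
  field
    n     : ℕ
    adj   : Fin n → Fin n → Bool
    sym   : ∀ u v → adj u v ≡ adj v u
    irrefl : ∀ v → adj v v ≡ false
open Graph public

Adj : (G : Graph) → Fin (n G) → Fin (n G) → Set
Adj G u v = adj G u v ≡ true

Connected : Graph → Set
Connected G = ∀ u v → Star (Adj G) u v

listed : ∀ {m} → List (Fin m × Fin m) → Fin m → Fin m → Bool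
listed F u v = any (λ { (a , b) → (⌊ a ≟ u ⌋ ∧ ⌊ b ≟ v ⌋) ∨ (⌊ a ≟ v ⌋ ∧ ⌊ b ≟ u ⌋) }) F

_─_ : (G : Graph) → List (Fin (n G) × Fin (n G)) → Graph
G ─ F = record
  { n = n G
  ; adj = λ u v → adj G u v ∧ not (listed F u v)
  ; sym = λ u v → sym' u v
  ; irrefl = λ v → irr v
  }
  where
  lsym : ∀ u v → listed F u v ≡ listed F v u
  lsym u v = go F
    where
    go : (F' : List (Fin (n G) × Fin (n G))) → listed F' u v ≡ listed F' v u
    go List.[] = refl
    go ((a , b) List.∷ F') with ⌊ a ≟ u ⌋ | ⌊ b ≟ v ⌋ | ⌊ a ≟ v ⌋ | ⌊ b ≟ u ⌋
    ... | true  | true  | true  | true  = refl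
    ... | true  | true  | true  | false = refl
    ... | true  | true  | false | true  = refl
    ... | true  | true  | false | false = refl
    ... | true  | false | true  | true  = refl
    ... | true  | false | true  | false = go F'
    ... | true  | false | false | true  = go F'
    ... | true  | false | false | false = go F'
    ... | false | true  | true  | true  = refl
    ... | false | true  | true  | false = go F'
    ... | false | true  | false | true  = go F'
    ... | false | true  | false | false = go F'
    ... | false | false | true  | true  = refl
    ... | false | false | true  | false = go F'
    ... | false | false | false | true  = go F'
    ... | false | false | false | false = go F'
  sym' : ∀ u v → (adj G u v ∧ not (listed F u v)) ≡ (adj G v u ∧ not (listed F v u))
  sym' u v rewrite sym G u v | lsym u v = refl
  irr : ∀ v → (adj G v v ∧ not (listed F v v)) ≡ false
  irr v rewrite irrefl G v = refl

KEdgeConnected : Graph → ℕ → Set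
KEdgeConnected G k =
  1 < n G × (∀ (F : List (Fin (n G) × Fin (n G))) → length F < k → Connected (G ─ F))

EdgeConnectivity : Graph → ℕ → Set
EdgeConnectivity G k = (k ≡ 0 ⊎ KEdgeConnected G k) × ¬ KEdgeConnected G (suc k)

degree : (G : Graph) → Fin (n G) → ℕ
degree G v = sum (map (λ w → if adj G v w then 1 else 0) (allFin (n G)))

MinDegree : Graph → ℕ → Set
MinDegree G d = Σ (Fin (n G)) (λ v → degree G v ≡ d) × (∀ v → d ≤ degree G v)

-- The double graph D[G] = G × T₂ on vertex set Fin (n * 2) ≅ Fin n × Fin 2
-- (via Data.Fin.remQuot); (u,i) ~ (v,j) iff u ~ v in G.
double : Graph → Graph
double G = record
  { n = n G * 2
  ; adj = λ x y → adj G (quotient 2 x) (quotient 2 y)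
  ; sym = λ x y → sym G (quotient 2 x) (quotient 2 y)
  ; irrefl = λ x → irrefl G (quotient 2 x)
  }

module Submission where

-- λ(D[G]) = min(4λ(G), 2δ(G)) for every G, and the three cases are instances of this.
-- Upper bounds: deleting the 2δ edges at one copy of a vertex of minimum degree isolates it,
-- and deleting the four lifts of each edge of a minimum edge cut of G disconnects D[G].
-- Lower bound: let F be fewer than min(4λ, 2δ) edges of D[G]. The two copies of a vertex u have
-- 2 deg u common neighbours and each edge of F blocks at most one of them, so every fibre stays
-- connected in D[G] − F. Fewer than λ edges of G have all four lifts in F; G without them is
-- still connected, every other edge of G keeps a lift in D[G] − F, and walks of G lift.

open import Defs hiding (sym)
open import Data.Bool as Bool using (Bool; true; false; if_then_else_; _∧_; _∨_; T; T?)
open import Data.Bool.Properties using (T-≡; T-∧; T-∨; T-not-≡; ¬-not)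
open import Data.Empty using (⊥-elim)
open import Data.Fin
  using (Fin; zero; suc; toℕ; _≟_; _↑ˡ_; _↑ʳ_; combine; remQuot; quotient; remainder; fromℕ<)
open import Data.Fin.Properties
  using (any?; all?; ¬∀⟶∃¬; toℕ-injective; remQuot-combine; combine-remQuot; combine-injectiveʳ)
open import Data.List as List using (List; []; _∷_; _++_; length; lookup; concatMap)
open import Data.List.Membership.Propositional using (_∈_)
open import Data.List.Membership.Propositional.Properties using (∈-concatMap⁺)
open import Data.List.Properties using (map-tabulate)
open import Data.List.Relation.Unary.Any as Any using (here; there; index)
open import Data.List.Relation.Unary.Any.Properties using (lookup-index)
open import Data.Nat using (ℕ; zero; suc; _+_; _*_; _⊓_; _<_; _≤_; z≤n; s≤s)
open import Data.Nat.ListAction using (sum)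
open import Data.Nat.Properties hiding (_≟_)
open import Algebra.Properties.Semiring.Sum +-*-semiring
  using (sum-syntax; ∑-comm; *-distribˡ-sum; sum-cong-≗)
open import Data.Product as Product using (_×_; _,_; proj₁; proj₂; ∃-syntax; uncurry)
open import Data.Sum as Sum using (_⊎_; inj₁; inj₂; [_,_]′)
open import Function using (_∘_; id; Equivalence)
open import Relation.Binary.Construct.Closure.ReflexiveTransitive using (Star; ε; _◅_; _◅◅_; gmap)
open import Relation.Binary.Definitions using (tri<; tri≈; tri>)
open import Relation.Binary.PropositionalEquality
  using (_≡_; _≢_; refl; sym; trans; subst; subst₂; cong; cong₂; module ≡-Reasoning)
open import Relation.Nullary using (¬_; Dec; yes; no; does; _×-dec_)
open import Relation.Nullary.Decidable using (⌊_⌋; dec-true; toWitness; fromWitness; map′)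

open Equivalence using (to; from)

𝟙 : Bool → ℕ
𝟙 b = if b then 1 else 0

count : ∀ {m} → (Fin m → Bool) → ℕ
count {m} P = ∑[ i < m ] 𝟙 (P i)

∑-mono-≤ : ∀ {m} {f g : Fin m → ℕ} → (∀ i → f i ≤ g i) → ∑[ i < m ] f i ≤ ∑[ i < m ] g i
∑-mono-≤ {zero}  _   = z≤n
∑-mono-≤ {suc m} f≤g = +-mono-≤ (f≤g zero) (∑-mono-≤ (f≤g ∘ suc))

∑-const : ∀ m c → ∑[ i < m ] c ≡ m * c
∑-const zero    c = refl
∑-const (suc m) c = cong (c +_) (∑-const m c)

∑-term-≤ : ∀ {m} (f : Fin m → ℕ) i → f i ≤ ∑[ j < m ] f j
∑-term-≤ f zero    = m≤m+n (f zero) _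
∑-term-≤ f (suc i) = ≤-trans (∑-term-≤ (f ∘ suc) i) (m≤n+m _ (f zero))

∑-𝟙-≟ : ∀ {m} (a : Fin m) → ∑[ i < m ] 𝟙 (does (a ≟ i)) ≡ 1
∑-𝟙-≟ {suc m} zero    = cong suc (trans (∑-const m 0) (*-zeroʳ m))
∑-𝟙-≟ {suc m} (suc a) = ∑-𝟙-≟ a

∑-splitAt : ∀ m {k} (f : Fin (m + k) → ℕ) →
  ∑[ z < m + k ] f z ≡ ∑[ i < m ] f (i ↑ˡ k) + ∑[ j < k ] f (m ↑ʳ j)
∑-splitAt zero    f = refl
∑-splitAt (suc m) f = trans (cong (f zero +_) (∑-splitAt m (f ∘ suc))) (sym (+-assoc (f zero) _ _))

∑-combine : ∀ m k (f : Fin (m * k) → ℕ) →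
  ∑[ z < m * k ] f z ≡ ∑[ i < m ] ∑[ j < k ] f (combine i j)
∑-combine zero    k f = refl
∑-combine (suc m) k f =
  trans (∑-splitAt k f) (cong (∑[ j < k ] f (j ↑ˡ m * k) +_) (∑-combine m k (f ∘ _↑ʳ_ {m * k} k)))

∑-remQuot : ∀ m k (f : Fin m × Fin k → ℕ) →
  ∑[ z < m * k ] f (remQuot k z) ≡ ∑[ i < m ] ∑[ j < k ] f (i , j)
∑-remQuot m k f = trans (∑-combine m k (f ∘ remQuot k))
  (sum-cong-≗ λ i → sum-cong-≗ λ j → cong f (remQuot-combine i j))

∑-quotient : ∀ m k (f : Fin m → ℕ) → ∑[ z < m * k ] f (quotient k z) ≡ k * ∑[ i < m ] f i
∑-quotient m k f = begin
  ∑[ z < m * k ] f (quotient k z)   ≡⟨ ∑-remQuot m k (f ∘ proj₁) ⟩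
  ∑[ i < m ] ∑[ j < k ] f i         ≡⟨ sum-cong-≗ (λ i → ∑-const k (f i)) ⟩
  ∑[ i < m ] (k * f i)              ≡⟨ *-distribˡ-sum k f ⟨
  k * ∑[ i < m ] f i                ∎
  where open ≡-Reasoning

∑∑-quotient : ∀ m k (f : Fin m → Fin m → ℕ) →
  ∑[ x < m * k ] ∑[ y < m * k ] f (quotient k x) (quotient k y) ≡ k * k * ∑[ a < m ] ∑[ b < m ] f a b
∑∑-quotient m k f = begin
  ∑[ x < m * k ] ∑[ y < m * k ] f (quotient k x) (quotient k y)
    ≡⟨ sum-cong-≗ (λ x → ∑-quotient m k (f (quotient k x))) ⟩
  ∑[ x < m * k ] (k * ∑[ b < m ] f (quotient k x) b)
    ≡⟨ ∑-quotient m k (λ a → k * ∑[ b < m ] f a b) ⟩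
  k * ∑[ a < m ] (k * ∑[ b < m ] f a b)
    ≡⟨ cong (k *_) (*-distribˡ-sum k (λ a → ∑[ b < m ] f a b)) ⟨
  k * (k * ∑[ a < m ] ∑[ b < m ] f a b)
    ≡⟨ *-assoc k k _ ⟨
  k * k * ∑[ a < m ] ∑[ b < m ] f a b
    ∎
  where open ≡-Reasoning

count-≤-cover : ∀ {m k} (P : Fin m → Bool) (g : Fin k → Fin m) →
  (∀ i → P i ≡ true → ∃[ j ] g j ≡ i) → count P ≤ k
count-≤-cover {m} {k} P g cover = begin
  count P                                   ≤⟨ ∑-mono-≤ P≤hits ⟩
  ∑[ i < m ] ∑[ j < k ] 𝟙 (does (g j ≟ i))  ≡⟨ ∑-comm (λ i j → 𝟙 (does (g j ≟ i))) ⟩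
  ∑[ j < k ] ∑[ i < m ] 𝟙 (does (g j ≟ i))  ≡⟨ sum-cong-≗ (∑-𝟙-≟ ∘ g) ⟩
  ∑[ j < k ] 1                              ≡⟨ ∑-const k 1 ⟩
  k * 1                                     ≡⟨ *-identityʳ k ⟩
  k                                         ∎
  where
  open ≤-Reasoning
  P≤hits : ∀ i → 𝟙 (P i) ≤ ∑[ j < k ] 𝟙 (does (g j ≟ i))
  P≤hits i with P i in Pi
  ... | false = z≤n
  ... | true with j , refl ← cover i Pi =
    subst (_≤ ∑[ j′ < k ] 𝟙 (does (g j′ ≟ g j))) (cong 𝟙 (dec-true (g j ≟ g j) refl))
      (∑-term-≤ (λ j′ → 𝟙 (does (g j′ ≟ g j))) j)

count-≤-length : ∀ {A : Set} {m} (P : Fin m → Bool) (g : A → Fin m) (xs : List A) →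
  (∀ i → P i ≡ true → ∃[ x ] x ∈ xs × g x ≡ i) → count P ≤ length xs
count-≤-length P g xs cover = count-≤-cover P (g ∘ lookup xs) λ i Pi →
  let x , x∈xs , gx≡i = cover i Pi
  in index x∈xs , trans (cong g (sym (lookup-index x∈xs))) gx≡i

tabulateWhere : ∀ {A : Set} {m} → (Fin m → Bool) → (Fin m → A) → List A
tabulateWhere {m = zero}  P f = []
tabulateWhere {m = suc m} P f =
  (if P zero then f zero ∷ [] else []) ++ tabulateWhere (P ∘ suc) (f ∘ suc)

length-tabulateWhere : ∀ {A : Set} {m} (P : Fin m → Bool) (f : Fin m → A) →
  length (tabulateWhere P f) ≡ count P
length-tabulateWhere {m = zero}  P f = refl
length-tabulateWhere {m = suc m} P f with P zero
... | true  = cong suc (length-tabulateWhere (P ∘ suc) (f ∘ suc))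
... | false = length-tabulateWhere (P ∘ suc) (f ∘ suc)

∈-tabulateWhere : ∀ {A : Set} {m} (P : Fin m → Bool) (f : Fin m → A) i →
  P i ≡ true → f i ∈ tabulateWhere P f
∈-tabulateWhere P f zero    Pi rewrite Pi = here refl
∈-tabulateWhere P f (suc i) Pi with P zero
... | true  = there (∈-tabulateWhere (P ∘ suc) (f ∘ suc) i Pi)
... | false = ∈-tabulateWhere (P ∘ suc) (f ∘ suc) i Pi

infix 4 _∈ᵉ_

_∈ᵉ_ : ∀ {m} → Fin m × Fin m → List (Fin m × Fin m) → Set
(u , v) ∈ᵉ F = (u , v) ∈ F ⊎ (v , u) ∈ F

∈ᵉ-swap : ∀ {m} {u v : Fin m} {F} → (u , v) ∈ᵉ F → (v , u) ∈ᵉ F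
∈ᵉ-swap = Sum.swap

module _ {m} {u v : Fin m} where

  private
    joins : Fin m × Fin m → Bool
    joins (a , b) = (⌊ a ≟ u ⌋ ∧ ⌊ b ≟ v ⌋) ∨ (⌊ a ≟ v ⌋ ∧ ⌊ b ≟ u ⌋)

    joins⁻ : ∀ {e} → T (joins e) → (u , v) ≡ e ⊎ (v , u) ≡ e
    joins⁻ {a , b} h = Sum.map endpoints endpoints (to (T-∨ {⌊ a ≟ u ⌋ ∧ ⌊ b ≟ v ⌋}) h)
      where
      endpoints : ∀ {a b x y : Fin m} → T (⌊ a ≟ x ⌋ ∧ ⌊ b ≟ y ⌋) → (x , y) ≡ (a , b)
      endpoints {a} {b} {x} {y} h with a≡x , b≡y ← to (T-∧ {⌊ a ≟ x ⌋}) h =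
        sym (cong₂ _,_ (toWitness {a? = a ≟ x} a≡x) (toWitness {a? = b ≟ y} b≡y))

    ⌊≟⌋-refl : ∀ (a : Fin m) → T ⌊ a ≟ a ⌋
    ⌊≟⌋-refl a = fromWitness {a? = a ≟ a} refl

    joins⁺ : ∀ {e} → (u , v) ≡ e ⊎ (v , u) ≡ e → T (joins e)
    joins⁺ (inj₁ refl) =
      from (T-∨ {⌊ u ≟ u ⌋ ∧ ⌊ v ≟ v ⌋}) (inj₁ (from T-∧ (⌊≟⌋-refl u , ⌊≟⌋-refl v)))
    joins⁺ (inj₂ refl) =
      from (T-∨ {⌊ v ≟ u ⌋ ∧ ⌊ u ≟ v ⌋}) (inj₂ (from T-∧ (⌊≟⌋-refl v , ⌊≟⌋-refl u)))

  listed⁻ : ∀ F → T (listed F u v) → (u , v) ∈ᵉ F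
  listed⁻ (e ∷ F) h with to T-∨ h
  ... | inj₁ joined = Sum.map here here (joins⁻ joined)
  ... | inj₂ later  = Sum.map there there (listed⁻ F later)

  listed⁺ : ∀ F → (u , v) ∈ᵉ F → T (listed F u v)
  listed⁺ (e ∷ F) (inj₁ (here uv≡e))  = from T-∨ (inj₁ (joins⁺ (inj₁ uv≡e)))
  listed⁺ (e ∷ F) (inj₂ (here vu≡e))  = from T-∨ (inj₁ (joins⁺ (inj₂ vu≡e)))
  listed⁺ (e ∷ F) (inj₁ (there uv∈F)) = from T-∨ (inj₂ (listed⁺ F (inj₁ uv∈F)))
  listed⁺ (e ∷ F) (inj₂ (there vu∈F)) = from T-∨ (inj₂ (listed⁺ F (inj₂ vu∈F)))

_∈ᵉ?_ : ∀ {m} (e : Fin m × Fin m) F → Dec (e ∈ᵉ F)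
(u , v) ∈ᵉ? F = map′ (listed⁻ F) (listed⁺ F) (T? (listed F u v))

module _ (G : Graph) (F : List (Fin (n G) × Fin (n G))) {u v : Fin (n G)} where

  adj-─⁻ : Adj (G ─ F) u v → Adj G u v × ¬ (u , v) ∈ᵉ F
  adj-─⁻ uv with uv-in-G , uv-not-listed ← to (T-∧ {adj G u v}) (from T-≡ uv) =
    to T-≡ uv-in-G ,
    λ uv∈F → subst T (to T-not-≡ uv-not-listed) (listed⁺ F uv∈F)

  adj-─⁺ : Adj G u v → ¬ (u , v) ∈ᵉ F → Adj (G ─ F) u v
  adj-─⁺ uv uv∉F = to T-≡ (from (T-∧ {adj G u v})
    (from T-≡ uv , from T-not-≡ (¬-not (uv∉F ∘ listed⁻ F ∘ from T-≡))))

Adj? : (H : Graph) → ∀ u v → Dec (Adj H u v)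
Adj? H u v = adj H u v Bool.≟ true

Star-first-step : ∀ {A : Set} {R : A → A → Set} {x y} → Star R x y → x ≡ y ⊎ ∃[ z ] R x z
Star-first-step ε        = inj₁ refl
Star-first-step (xz ◅ _) = inj₂ (_ , xz)

adj⇒≢ : (H : Graph) {u v : Fin (n H)} → Adj H u v → u ≢ v
adj⇒≢ H {u} uv refl with () ← trans (sym uv) (irrefl H u)

another-vertex : ∀ {m} → 1 < m → (v : Fin m) → ∃[ w ] w ≢ v
another-vertex (s≤s (s≤s _)) zero    = suc zero , λ ()
another-vertex (s≤s (s≤s _)) (suc v) = zero , λ ()

1<size : ∀ {m} {a b : Fin m} → a ≢ b → 1 < m
1<size {suc zero}    {zero} {zero} a≢b = ⊥-elim (a≢b refl)
1<size {suc (suc m)} _                 = s≤s (s≤s z≤n)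

sum-tabulate : ∀ {m} (f : Fin m → ℕ) → sum (List.tabulate f) ≡ ∑[ i < m ] f i
sum-tabulate {zero}  f = refl
sum-tabulate {suc m} f = cong (f zero +_) (sum-tabulate (f ∘ suc))

degree≡∑ : (H : Graph) (v : Fin (n H)) → degree H v ≡ ∑[ w < n H ] 𝟙 (adj H v w)
degree≡∑ H v = trans (cong sum (map-tabulate id (𝟙 ∘ adj H v))) (sum-tabulate (𝟙 ∘ adj H v))

¬KEdgeConnected-suc-degree : (H : Graph) (v : Fin (n H)) → ¬ KEdgeConnected H (suc (degree H v))
¬KEdgeConnected-suc-degree H v (1<n , connected) =
  let w , w≢v = another-vertex 1<n v
  in [ w≢v ∘ sym , v-isolated ∘ proj₂ ]′ (Star-first-step (connected star |star|≤degree v w))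
  where
  star : List (Fin (n H) × Fin (n H))
  star = tabulateWhere (adj H v) (v ,_)
  |star|≤degree : length star < suc (degree H v)
  |star|≤degree = s≤s (≤-reflexive (trans (length-tabulateWhere (adj H v) (v ,_)) (sym (degree≡∑ H v))))
  v-isolated : ∀ {z} → ¬ Adj (H ─ star) v z
  v-isolated {z} vz with vz-in-H , vz∉star ← adj-─⁻ H star vz =
    vz∉star (inj₁ (∈-tabulateWhere (adj H v) (v ,_) z vz-in-H))

quotient-combine : ∀ {m k} (a : Fin m) (i : Fin k) → quotient k (combine a i) ≡ a
quotient-combine a i = cong proj₁ (remQuot-combine a i)

module _ (G : Graph) where

  private
    N : ℕ
    N = n G
    D : Graph
    D = double G
    q : Fin (N * 2) → Fin N
    q = quotient 2
    Edges : Set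
    Edges = List (Fin (N * 2) × Fin (N * 2))

  degree-double : ∀ x → degree D x ≡ 2 * degree G (q x)
  degree-double x = begin
    degree D x                              ≡⟨ degree≡∑ D x ⟩
    ∑[ z < N * 2 ] 𝟙 (adj G (q x) (q z))   ≡⟨ ∑-quotient N 2 (𝟙 ∘ adj G (q x)) ⟩
    2 * ∑[ w < N ] 𝟙 (adj G (q x) w)        ≡⟨ cong (2 *_) (degree≡∑ G (q x)) ⟨
    2 * degree G (q x)                      ∎
    where open ≡-Reasoning

  ¬KEdgeConnected-double-2δ : ∀ {d} → MinDegree G d → ¬ KEdgeConnected D (suc (2 * d))
  ¬KEdgeConnected-double-2δ {d} ((v , degree≡d) , _) =
    subst (λ k → ¬ KEdgeConnected D (suc k)) degree≡2d (¬KEdgeConnected-suc-degree D (combine v zero))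
    where
    degree≡2d : degree D (combine v zero) ≡ 2 * d
    degree≡2d = trans (degree-double (combine v zero))
                      (cong (2 *_) (trans (cong (degree G) (quotient-combine v zero)) degree≡d))

  lifts : Fin N × Fin N → Edges
  lifts (a , b) = (combine a zero , combine b zero)     ∷ (combine a zero , combine b (suc zero))
                ∷ (combine a (suc zero) , combine b zero) ∷ (combine a (suc zero) , combine b (suc zero))
                ∷ []

  ∈-lifts : ∀ {a b} i j → (combine a i , combine b j) ∈ lifts (a , b)
  ∈-lifts zero       zero       = here refl
  ∈-lifts zero       (suc zero) = there (here refl)
  ∈-lifts (suc zero) zero       = there (there (here refl))
  ∈-lifts (suc zero) (suc zero) = there (there (there (here refl)))

  liftAll : List (Fin N × Fin N) → Edges
  liftAll = concatMap lifts

  length-liftAll : ∀ F → length (liftAll F) ≡ 4 * length F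
  length-liftAll []      = refl
  length-liftAll (e ∷ F) = trans (cong (4 +_) (length-liftAll F)) (sym (*-suc 4 (length F)))

  ∈-liftAll : ∀ {F x y} → (q x , q y) ∈ F → (x , y) ∈ liftAll F
  ∈-liftAll {F} {x} {y} qxqy∈F =
    subst₂ (λ x′ y′ → (x′ , y′) ∈ liftAll F) (combine-remQuot {N} 2 x) (combine-remQuot {N} 2 y)
      (∈-concatMap⁺ lifts (Any.map (λ { refl → ∈-lifts (remainder {N} 2 x) (remainder {N} 2 y) }) qxqy∈F))

  adj-─liftAll⁻ : ∀ F {x y} → Adj (D ─ liftAll F) x y → Adj (G ─ F) (q x) (q y)
  adj-─liftAll⁻ F xy with xy-in-D , xy∉liftAll ← adj-─⁻ D (liftAll F) xy =
    adj-─⁺ G F xy-in-D (xy∉liftAll ∘ Sum.map ∈-liftAll ∈-liftAll)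

  ¬KEdgeConnected-double-4λ : ∀ {l} → ¬ KEdgeConnected G (suc l) → ¬ KEdgeConnected D (suc (4 * l))
  ¬KEdgeConnected-double-4λ {l} ¬λ>l (1<2N , connectedD) = ¬λ>l (1<N , connectedG)
    where
    a : Fin N
    a = q (fromℕ< (<⇒≤ 1<2N))
    copies-distinct : combine a zero ≢ combine a (suc zero)
    copies-distinct eq with () ← combine-injectiveʳ a zero a (suc zero) eq
    -- For N = 1, D[G] would consist of two non-adjacent vertices.
    1<N : 1 < N
    1<N = [ ⊥-elim ∘ copies-distinct , (λ (z , a₀z) → 1<size (adj⇒≢ G (a~qz a₀z))) ]′
            (Star-first-step (connectedD [] (s≤s z≤n) (combine a zero) (combine a (suc zero))))
      where
      a~qz : ∀ {z} → Adj (D ─ []) (combine a zero) z → Adj G a (q z)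
      a~qz {z} a₀z = subst (λ b → Adj G b (q z)) (quotient-combine a zero) (proj₁ (adj-─⁻ D [] a₀z))
    connectedG : ∀ F → length F < suc l → Connected (G ─ F)
    connectedG F |F|≤l u v =
      subst₂ (Star (Adj (G ─ F))) (quotient-combine u zero) (quotient-combine v zero)
        (gmap q (adj-─liftAll⁻ F) (connectedD (liftAll F) |liftAll|≤4l (combine u zero) (combine v zero)))
      where
      |liftAll|≤4l : length (liftAll F) < suc (4 * l)
      |liftAll|≤4l = s≤s (subst (_≤ 4 * l) (sym (length-liftAll F)) (*-monoʳ-≤ 4 (≤-pred |F|≤l)))

  -- An edge of F blocking a common neighbour z of two copies of u joins z to one of them,
  -- so z is its endpoint outside the fibre of u.
  far : Fin N → Fin (N * 2) × Fin (N * 2) → Fin (N * 2)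
  far u (a , b) with q a ≟ u
  ... | yes _ = b
  ... | no _  = a

  far-∈ᵉ : ∀ {F u w z} → q w ≡ u → q z ≢ u → (w , z) ∈ᵉ F → ∃[ e ] e ∈ F × far u e ≡ z
  far-∈ᵉ {u = u} {w} {z} qw≡u qz≢u (inj₁ wz∈F) = (w , z) , wz∈F , far-wz
    where
    far-wz : far u (w , z) ≡ z
    far-wz with q w ≟ u
    ... | yes _     = refl
    ... | no qw≢u   = ⊥-elim (qw≢u qw≡u)
  far-∈ᵉ {u = u} {w} {z} qw≡u qz≢u (inj₂ zw∈F) = (z , w) , zw∈F , far-zw
    where
    far-zw : far u (z , w) ≡ z
    far-zw with q z ≟ u
    ... | yes qz≡u = ⊥-elim (qz≢u qz≡u)
    ... | no _     = refl

  common-neighbour : ∀ F {u x y} → length F < 2 * degree G u → q x ≡ u → q y ≡ u → Star (Adj (D ─ F)) x y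
  common-neighbour F {u} {x} {y} |F|<2deg qx≡u qy≡u
    with any? (λ z → Adj? (D ─ F) x z ×-dec Adj? (D ─ F) z y)
  ... | yes (z , xz , zy) = xz ◅ zy ◅ ε
  ... | no no-path        = ⊥-elim (<⇒≱ |F|<2deg 2deg≤|F|)
    where
    covered : ∀ z → adj G u (q z) ≡ true → ∃[ e ] e ∈ F × far u e ≡ z
    covered z uz with (x , z) ∈ᵉ? F | (z , y) ∈ᵉ? F
    ... | yes xz∈F | _        = far-∈ᵉ qx≡u (adj⇒≢ G uz ∘ sym) xz∈F
    ... | no _     | yes zy∈F = far-∈ᵉ qy≡u (adj⇒≢ G uz ∘ sym) (∈ᵉ-swap zy∈F)
    ... | no xz∉F  | no zy∉F  = ⊥-elim (no-path (z , adj-─⁺ D F xz xz∉F , adj-─⁺ D F zy zy∉F))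
      where
      xz : Adj D x z
      xz = subst (λ b → Adj G b (q z)) (sym qx≡u) uz
      zy : Adj D z y
      zy = subst (λ b → Adj G (q z) b) (sym qy≡u) (trans (Graph.sym G (q z) u) uz)
    2deg≤|F| : 2 * degree G u ≤ length F
    2deg≤|F| = subst (_≤ length F) count≡2deg (count-≤-length (adj G u ∘ q) (far u) F covered)
      where
      count≡2deg : count (adj G u ∘ q) ≡ 2 * degree G u
      count≡2deg = trans (∑-quotient N 2 (𝟙 ∘ adj G u)) (cong (2 *_) (sym (degree≡∑ G u)))

  -- Oriented from the lower to the higher fibre, an edge of F is the lift of at most one ordered
  -- pair a < b of vertices of G.
  orient : Fin (N * 2) × Fin (N * 2) → Fin (N * 2) × Fin (N * 2)
  orient (x , y) with toℕ (q x) <? toℕ (q y)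
  ... | yes _ = x , y
  ... | no _  = y , x

  orient-∈ᵉ : ∀ {F x y} → toℕ (q x) < toℕ (q y) → (x , y) ∈ᵉ F → ∃[ e ] e ∈ F × orient e ≡ (x , y)
  orient-∈ᵉ {x = x} {y} qx<qy (inj₁ xy∈F) = (x , y) , xy∈F , orient-xy
    where
    orient-xy : orient (x , y) ≡ (x , y)
    orient-xy with toℕ (q x) <? toℕ (q y)
    ... | yes _     = refl
    ... | no qx≮qy  = ⊥-elim (qx≮qy qx<qy)
  orient-∈ᵉ {x = x} {y} qx<qy (inj₂ yx∈F) = (y , x) , yx∈F , orient-yx
    where
    orient-yx : orient (y , x) ≡ (x , y)
    orient-yx with toℕ (q y) <? toℕ (q x)
    ... | yes qy<qx = ⊥-elim (<-asym qx<qy qy<qx)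
    ... | no _      = refl

  module _ (F : Edges) where

    Cut : Fin N × Fin N → Set
    Cut (a , b) = ∀ i j → (combine a i , combine b j) ∈ᵉ F

    cut? : ∀ e → Dec (Cut e)
    cut? (a , b) = all? λ i → all? λ j → (combine a i , combine b j) ∈ᵉ? F

    Cut-swap : ∀ {a b} → Cut (a , b) → Cut (b , a)
    Cut-swap ab i j = ∈ᵉ-swap (ab j i)

    OrderedCut : Fin N × Fin N → Set
    OrderedCut (a , b) = toℕ a < toℕ b × Cut (a , b)

    orderedCut? : ∀ e → Dec (OrderedCut e)
    orderedCut? (a , b) = (toℕ a <? toℕ b) ×-dec cut? (a , b)

    cutEdges : List (Fin N × Fin N)
    cutEdges = tabulateWhere (λ w → ⌊ orderedCut? (remQuot N w) ⌋) (remQuot N)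

    ∈-cutEdges : ∀ {e} → OrderedCut e → e ∈ cutEdges
    ∈-cutEdges {a , b} ab = subst (_∈ cutEdges) (remQuot-combine a b)
      (∈-tabulateWhere _ (remQuot N) (combine a b) (to T-≡ (fromWitness {a? = orderedCut? _} ab′)))
      where
      ab′ : OrderedCut (remQuot N (combine a b))
      ab′ = subst OrderedCut (sym (remQuot-combine a b)) ab

    lift-edge : ∀ {a c} → Adj (G ─ cutEdges) a c → ∃[ x ] ∃[ y ] q x ≡ a × q y ≡ c × Adj (D ─ F) x y
    lift-edge {a} {c} ac with adj-─⁻ G cutEdges ac | cut? (a , c)
    ... | ac-in-G , ac∉cutEdges | yes cut = ⊥-elim (ac∉cutEdges cut-listed)
      where
      cut-listed : (a , c) ∈ᵉ cutEdges
      cut-listed with <-cmp (toℕ a) (toℕ c)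
      ... | tri< a<c _ _ = inj₁ (∈-cutEdges (a<c , cut))
      ... | tri≈ _ a≡c _ = ⊥-elim (adj⇒≢ G ac-in-G (toℕ-injective a≡c))
      ... | tri> _ _ c<a = inj₂ (∈-cutEdges (c<a , Cut-swap cut))
    ... | ac-in-G , _ | no ¬cut
      with i , ¬∀j ← ¬∀⟶∃¬ 2 _ (λ i → all? λ j → _ ∈ᵉ? F) ¬cut
      with j , xy∉F ← ¬∀⟶∃¬ 2 _ (λ j → _ ∈ᵉ? F) ¬∀j
      = combine a i , combine c j , quotient-combine a i , quotient-combine c j ,
        adj-─⁺ D F (subst₂ (Adj G) (sym (quotient-combine a i)) (sym (quotient-combine c j)) ac-in-G) xy∉F

    4*|cutEdges|≤|F| : 4 * length cutEdges ≤ length F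
    4*|cutEdges|≤|F| =
      subst (_≤ length F) count≡4*|cutEdges| (count-≤-length P (uncurry combine ∘ orient) F covered)
      where
      P : Fin ((N * 2) * (N * 2)) → Bool
      P w = ⌊ orderedCut? (Product.map q q (remQuot (N * 2) w)) ⌋
      covered : ∀ w → P w ≡ true → ∃[ e ] e ∈ F × uncurry combine (orient e) ≡ w
      covered w Pw with qx<qy , cut ← toWitness (from T-≡ Pw)
        with e , e∈F , orient-e ← orient-∈ᵉ qx<qy
               (subst₂ (λ x y → (x , y) ∈ᵉ F) (combine-remQuot {N} 2 _) (combine-remQuot {N} 2 _) (cut _ _))
        = e , e∈F , trans (cong (uncurry combine) orient-e) (combine-remQuot {N * 2} (N * 2) w)
      count≡4*|cutEdges| : count P ≡ 4 * length cutEdges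
      count≡4*|cutEdges| = begin
        count P
          ≡⟨ ∑-remQuot (N * 2) (N * 2) (λ (x , y) → 𝟙 ⌊ orderedCut? (q x , q y) ⌋) ⟩
        ∑[ x < N * 2 ] ∑[ y < N * 2 ] 𝟙 ⌊ orderedCut? (q x , q y) ⌋
          ≡⟨ ∑∑-quotient N 2 (λ a b → 𝟙 ⌊ orderedCut? (a , b) ⌋) ⟩
        4 * ∑[ a < N ] ∑[ b < N ] 𝟙 ⌊ orderedCut? (a , b) ⌋
          ≡⟨ cong (4 *_) (∑-remQuot N N (λ e → 𝟙 ⌊ orderedCut? e ⌋)) ⟨
        4 * count (λ w → ⌊ orderedCut? (remQuot N w) ⌋)
          ≡⟨ cong (4 *_) (length-tabulateWhere (λ w → ⌊ orderedCut? (remQuot N w) ⌋) (remQuot N)) ⟨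
        4 * length cutEdges
          ∎
        where open ≡-Reasoning

    lift-walk : (∀ u → length F < 2 * degree G u) →
      ∀ {a b x y} → Star (Adj (G ─ cutEdges)) a b → q x ≡ a → q y ≡ b → Star (Adj (D ─ F)) x y
    lift-walk |F|<2deg ε qx≡a qy≡a = common-neighbour F (|F|<2deg _) qx≡a qy≡a
    lift-walk |F|<2deg (ac ◅ walk) qx≡a qy≡b with x′ , y′ , qx′≡a , qy′≡c , x′y′ ← lift-edge ac =
      common-neighbour F (|F|<2deg _) qx≡a qx′≡a ◅◅ x′y′ ◅ lift-walk |F|<2deg walk qy′≡c qy≡b

  KEdgeConnected-double : ∀ {l d k} → KEdgeConnected G l → MinDegree G d → k ≤ 4 * l → k ≤ 2 * d →
    KEdgeConnected D k
  KEdgeConnected-double {l} {d} {k} (1<N , connectedG) (_ , δ≤degree) k≤4l k≤2d =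
    ≤-trans 1<N (m≤m*n N 2) , connectedD
    where
    connectedD : ∀ F → length F < k → Connected (D ─ F)
    connectedD F |F|<k x y =
      lift-walk F |F|<2deg (connectedG (cutEdges F) |cutEdges|<l (q x) (q y)) refl refl
      where
      |F|<2deg : ∀ u → length F < 2 * degree G u
      |F|<2deg u = <-≤-trans |F|<k (≤-trans k≤2d (*-monoʳ-≤ 2 (δ≤degree u)))
      |cutEdges|<l : length (cutEdges F) < l
      |cutEdges|<l = *-cancelˡ-< 4 _ _ (≤-<-trans (4*|cutEdges|≤|F| F) (<-≤-trans |F|<k k≤4l))

edgeConnectivity-double : (G : Graph) {l d : ℕ} → EdgeConnectivity G l → MinDegree G d →
  EdgeConnectivity (double G) ((4 * l) ⊓ (2 * d))
edgeConnectivity-double G {l} {d} (λ≥l , λ≯l) δ = λD≥min λ≥l , λD≯min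
  where
  λD≥min : l ≡ 0 ⊎ KEdgeConnected G l →
    (4 * l) ⊓ (2 * d) ≡ 0 ⊎ KEdgeConnected (double G) ((4 * l) ⊓ (2 * d))
  λD≥min (inj₁ refl) = inj₁ (n≤0⇒n≡0 (m⊓n≤m 0 (2 * d)))
  λD≥min (inj₂ λ≥l)  =
    inj₂ (KEdgeConnected-double G λ≥l δ (m⊓n≤m (4 * l) (2 * d)) (m⊓n≤n (4 * l) (2 * d)))
  λD≯ : ℕ → Set
  λD≯ k = ¬ KEdgeConnected (double G) (suc k)
  λD≯min : λD≯ ((4 * l) ⊓ (2 * d))
  λD≯min = [ (λ min≡4l → subst λD≯ (sym min≡4l) (¬KEdgeConnected-double-4λ G λ≯l))
           , (λ min≡2d → subst λD≯ (sym min≡2d) (¬KEdgeConnected-double-2δ G δ))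
           ]′ (⊓-sel (4 * l) (2 * d))

theorem3p4 : (G : Graph) (l d : ℕ) → EdgeConnectivity G l → MinDegree G d →
    ((l ≡ d → EdgeConnectivity (double G) (2 * l))
    × (2 * l ≤ d → EdgeConnectivity (double G) (4 * l))
    × (d < 2 * l → l < d → EdgeConnectivity (double G) (2 * d)))
theorem3p4 G l d λG δG = λ≡δ , 2λ≤δ , δ<2λ
  where
  λD : EdgeConnectivity (double G) ((4 * l) ⊓ (2 * d))
  λD = edgeConnectivity-double G λG δG
  λ≡δ : l ≡ d → EdgeConnectivity (double G) (2 * l)
  λ≡δ refl = subst (EdgeConnectivity (double G)) (m≥n⇒m⊓n≡n (*-monoˡ-≤ l {2} {4} (s≤s (s≤s z≤n)))) λD
  2λ≤δ : 2 * l ≤ d → EdgeConnectivity (double G) (4 * l)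
  2λ≤δ 2l≤d = subst (EdgeConnectivity (double G)) (m≤n⇒m⊓n≡m 4l≤2d) λD
    where
    4l≤2d : 4 * l ≤ 2 * d
    4l≤2d = subst (_≤ 2 * d) (sym (*-assoc 2 2 l)) (*-monoʳ-≤ 2 2l≤d)
  δ<2λ : d < 2 * l → l < d → EdgeConnectivity (double G) (2 * d)
  δ<2λ d<2l _ = subst (EdgeConnectivity (double G)) (m≥n⇒m⊓n≡n 2d≤4l) λD
    where
    2d≤4l : 2 * d ≤ 4 * l
    2d≤4l = subst (2 * d ≤_) (sym (*-assoc 2 2 l)) (*-monoʳ-≤ 2 (<⇒≤ d<2l))
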